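{- Assume that $U$ and $V$ are consistent subsets of $D$ with $U\subseteq V$. Then $G(U)\subseteq G(V)$ and $F(U)\subseteq F(V)$.
   Context: $L$ is an MA (mathematically agreeable) language: its syntax contains a countable syntax of first-order predicate logic with equality, with natural numbers and numerals as terms; $L$ is fully interpreted (each sentence of $L$ is either true or false, not both); classical truth tables hold for $\neg,\vee,\wedge,\rightarrow,\leftrightarrow$ on sentences of $L$; classical truth rules hold for $\forall xP(x)$, $\exists xP(x)$. $T$ is a monadic predicate letter not in $L$. $\mathcal L$ has as basic sentences the sentences of $L$, $T(\mathbf n)$ for numerals $\mathbf n$, and $\forall xT(x)$, $\exists xT(x)$, $\forall x\neg T(x)$, $\exists x\neg T(x)$, and is closed under $\neg,\vee,\wedge,\rightarrow,\leftrightarrow$. With a fixed Gödel numbering, $\#A$ is the Gödel number of $A$, $\lceil A\rceil$ its numeral; $D$ is the set of Gödel numbers of sentences of $\mathcal L$; $W$ the set of Gödel numbers of true sentences of $L$. A set $U\subseteq D$ is consistent if no sentence $A$ of $\mathcal L$ has both $\#A\in U$ and $\#[\neg A]\in U$. For $U\subseteq D$: $D_1(U)=\{\#T(\mathbf n):\mathbf n=\lceil A\rceil,\ \#A\in U\}$, $D_2(U)=\{\#[\neg T(\mathbf n)]:\mathbf n=\lceil A\rceil,\ \#[\neg A]\in U\}$. $G_0(U)=W$ if $U=\emptyset$; $=W\cup D_1(U)\cup\{\#[\exists xT(x)],\#[\neg\forall x\neg T(x)]\}$ if $\emptyset\subsetneq U\subsetneq D$ and $D_2(U)=\emptyset$;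 $=W\cup D_1(U)\cup D_2(U)\cup\{\#[\exists xT(x)],\#[\neg\forall x\neg T(x)],\#[\neg\forall xT(x)],\#[\exists x\neg T(x)]\}$ if $\emptyset\subsetneq U\subsetneq D$ and $D_2(U)\neq\emptyset$; $=W\cup D_1(U)\cup D_2(U)\cup\{\#[\exists xT(x)],\#[\neg\exists xT(x)],\#[\forall xT(x)],\#[\neg\forall xT(x)],\#[\forall x\neg T(x)],\#[\neg\forall x\neg T(x)],\#[\exists x\neg T(x)],\#[\neg\exists x\neg T(x)]\}$ if $U=D$. $G_{n+1}(U)$ is $G_n(U)$ together with: $\#[A\vee B]$ when $\#A$ or $\#B\in G_n(U)$; $\#[A\wedge B]$ when $\#A,\#B\in G_n(U)$; $\#[A\rightarrow B]$ when $\#[\neg A]$ or $\#B\in G_n(U)$; $\#[A\leftrightarrow B]$ when both $\#A,\#B$ or both $\#[\neg A],\#[\neg B]$ are in $G_n(U)$; $\#[\neg(A\vee B)]$ when $\#[\neg A],\#[\neg B]\in G_n(U)$; $\#[\neg(A\wedge B)]$ when $\#[\neg A]$ or $\#[\neg B]\in G_n(U)$; $\#[\neg(A\rightarrow B)]$ when $\#A,\#[\neg B]\in G_n(U)$; $\#[\neg(A\leftrightarrow B)]$ when both $\#A,\#[\neg B]$ or both $\#[\neg A],\#B$ are in $G_n(U)$; $\#[\neg(\neg A)]$ when $\#A\in G_n(U)$ ($A,B$ sentences of $\mathcal L$). $G(U)=\bigcup_{n\ge0}G_n(U)$, $F(U)=\{\#A:\#[\neg A]\in G(U)\}$. -}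

module Defs where

open import Level using (0ℓ)
open import Data.Nat using (ℕ; zero; suc)
open import Data.Bool using (Bool; true; false; not; _∨_; _∧_)
open import Data.Product using (Σ; ∃; _×_; _,_)
open import Data.Sum using (_⊎_)
open import Relation.Nullary using (¬_)
open import Relation.Unary using (Pred; _∈_; _∉_; _⊆_)
open import Relation.Binary.PropositionalEquality using (_≡_)
open import Function.Definitions using (Injective)

_⇒ᵇ_ : Bool → Bool → Bool
a ⇒ᵇ b = not a ∨ b

_⇔ᵇ_ : Bool → Bool → Bool
a ⇔ᵇ b = (a ⇒ᵇ b) ∧ (b ⇒ᵇ a)

_iff_ : Set → Set → Set
P iff Q = (P → Q) × (Q → P)

-- Sentences of L, one-variable formulas P(x) of L with instantiation by
-- numerals, the connectives and quantifiers of L, and a Bool-valued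
-- truth assignment (so every sentence is either true or false, not both),
-- obeying the classical truth tables and the classical truth rules for
-- quantifiers (over the natural numbers, named by numerals).
record MALanguage : Set₁ where
  field
    LSent  : Set
    LForm  : Set
    inst   : LForm → ℕ → LSent    -- P(n) : substitute the numeral of n for x
    ¬L_    : LSent → LSent
    _∨L_ _∧L_ _→L_ _↔L_ : LSent → LSent → LSent
    ∀L ∃L  : LForm → LSent
    val    : LSent → Bool
    val-¬  : ∀ A → val (¬L A) ≡ not (val A)
    val-∨  : ∀ A B → val (A ∨L B) ≡ (val A ∨ val B)
    val-∧  : ∀ A B → val (A ∧L B) ≡ (val A ∧ val B)
    val-→  : ∀ A B → val (A →L B) ≡ (val A ⇒ᵇ val B)
    val-↔  : ∀ A B → val (A ↔L B) ≡ (val A ⇔ᵇ val B)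
    val-∀  : ∀ P → (val (∀L P) ≡ true) iff (∀ n → val (inst P n) ≡ true)
    val-∃  : ∀ P → (val (∃L P) ≡ true) iff (∃ λ n → val (inst P n) ≡ true)

  True : LSent → Set
  True A = val A ≡ true

data Sent (LS : Set) : Set where
  ⌜_⌝     : LS → Sent LS
  T       : ℕ → Sent LS
  ∀T ∃T ∀¬T ∃¬T : Sent LS          -- ∀xT(x), ∃xT(x), ∀x¬T(x), ∃x¬T(x)
  ~_      : Sent LS → Sent LS
  _∨′_ _∧′_ _⇒′_ _⇔′_ : Sent LS → Sent LS → Sent LS

record GödelNumbering (LS : Set) : Set where
  field
    ♯     : Sent LS → ℕ
    ♯-inj : Injective _≡_ _≡_ ♯

module Construction (M : MALanguage) (g : GödelNumbering (MALanguage.LSent M)) where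
  open MALanguage M
  open GödelNumbering g

  S : Set
  S = Sent LSent

  D : Pred ℕ 0ℓ
  D k = ∃ λ (A : S) → ♯ A ≡ k

  W : Pred ℕ 0ℓ
  W k = ∃ λ (A : LSent) → True A × ♯ ⌜ A ⌝ ≡ k

  Consistent : Pred ℕ 0ℓ → Set
  Consistent U = ∀ (A : S) → ¬ (♯ A ∈ U × ♯ (~ A) ∈ U)

  D₁ : Pred ℕ 0ℓ → Pred ℕ 0ℓ
  D₁ U k = ∃ λ (A : S) → ♯ A ∈ U × ♯ (T (♯ A)) ≡ k

  D₂ : Pred ℕ 0ℓ → Pred ℕ 0ℓ
  D₂ U k = ∃ λ (A : S) → ♯ (~ A) ∈ U × ♯ (~ T (♯ A)) ≡ k

  IsEmpty : Pred ℕ 0ℓ → Set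
  IsEmpty U = ∀ k → k ∉ U

  NonEmpty : Pred ℕ 0ℓ → Set
  NonEmpty U = ∃ λ k → k ∈ U

  ProperNonEmpty : Pred ℕ 0ℓ → Set
  ProperNonEmpty U = NonEmpty U × U ⊆ D × (∃ λ k → k ∈ D × k ∉ U)

  IsD : Pred ℕ 0ℓ → Set
  IsD U = U ⊆ D × D ⊆ U

  -- the finite sets of Gödel numbers added in the three nontrivial cases
  Extra₂ : Pred ℕ 0ℓ
  Extra₂ k = (k ≡ ♯ ∃T) ⊎ (k ≡ ♯ (~ ∀¬T))

  Extra₄ : Pred ℕ 0ℓ
  Extra₄ k = (k ≡ ♯ ∃T) ⊎ (k ≡ ♯ (~ ∀¬T)) ⊎ (k ≡ ♯ (~ ∀T)) ⊎ (k ≡ ♯ ∃¬T)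

  Extra₈ : Pred ℕ 0ℓ
  Extra₈ k = (k ≡ ♯ ∃T) ⊎ (k ≡ ♯ (~ ∃T)) ⊎ (k ≡ ♯ ∀T) ⊎ (k ≡ ♯ (~ ∀T))
           ⊎ (k ≡ ♯ ∀¬T) ⊎ (k ≡ ♯ (~ ∀¬T)) ⊎ (k ≡ ♯ ∃¬T) ⊎ (k ≡ ♯ (~ ∃¬T))

  G₀ : Pred ℕ 0ℓ → Pred ℕ 0ℓ
  G₀ U k =
      (IsEmpty U × W k)
    ⊎ (ProperNonEmpty U × IsEmpty (D₂ U) × (W k ⊎ D₁ U k ⊎ Extra₂ k))
    ⊎ (ProperNonEmpty U × NonEmpty (D₂ U) × (W k ⊎ D₁ U k ⊎ D₂ U k ⊎ Extra₄ k))
    ⊎ (IsD U × (W k ⊎ D₁ U k ⊎ D₂ U k ⊎ Extra₈ k))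

  data Step (X : Pred ℕ 0ℓ) : Pred ℕ 0ℓ where
    ∨-l   : ∀ {A B} → ♯ A ∈ X → Step X (♯ (A ∨′ B))
    ∨-r   : ∀ {A B} → ♯ B ∈ X → Step X (♯ (A ∨′ B))
    ∧-i   : ∀ {A B} → ♯ A ∈ X → ♯ B ∈ X → Step X (♯ (A ∧′ B))
    ⇒-l   : ∀ {A B} → ♯ (~ A) ∈ X → Step X (♯ (A ⇒′ B))
    ⇒-r   : ∀ {A B} → ♯ B ∈ X → Step X (♯ (A ⇒′ B))
    ⇔-tt  : ∀ {A B} → ♯ A ∈ X → ♯ B ∈ X → Step X (♯ (A ⇔′ B))
    ⇔-ff  : ∀ {A B} → ♯ (~ A) ∈ X → ♯ (~ B) ∈ X → Step X (♯ (A ⇔′ B))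
    ¬∨-i  : ∀ {A B} → ♯ (~ A) ∈ X → ♯ (~ B) ∈ X → Step X (♯ (~ (A ∨′ B)))
    ¬∧-l  : ∀ {A B} → ♯ (~ A) ∈ X → Step X (♯ (~ (A ∧′ B)))
    ¬∧-r  : ∀ {A B} → ♯ (~ B) ∈ X → Step X (♯ (~ (A ∧′ B)))
    ¬⇒-i  : ∀ {A B} → ♯ A ∈ X → ♯ (~ B) ∈ X → Step X (♯ (~ (A ⇒′ B)))
    ¬⇔-tf : ∀ {A B} → ♯ A ∈ X → ♯ (~ B) ∈ X → Step X (♯ (~ (A ⇔′ B)))
    ¬⇔-ft : ∀ {A B} → ♯ (~ A) ∈ X → ♯ B ∈ X → Step X (♯ (~ (A ⇔′ B)))
    ¬¬-i  : ∀ {A} → ♯ A ∈ X → Step X (♯ (~ (~ A)))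

  Gₙ : ℕ → Pred ℕ 0ℓ → Pred ℕ 0ℓ
  Gₙ zero    U = G₀ U
  Gₙ (suc n) U = λ k → Gₙ n U k ⊎ Step (Gₙ n U) k

  G : Pred ℕ 0ℓ → Pred ℕ 0ℓ
  G U k = ∃ λ n → Gₙ n U k

  F : Pred ℕ 0ℓ → Pred ℕ 0ℓ
  F U k = ∃ λ (A : S) → ♯ A ≡ k × ♯ (~ A) ∈ G U

module Submission where

-- G₀ U is defined by four cases, but in every nonempty case it is one of
-- three nested "layers":  W ∪ D₁(U) ∪ Extra₂ ⊆ W ∪ D₁(U) ∪ D₂(U) ∪ Extra₄
-- ⊆ W ∪ D₁(U) ∪ D₂(U) ∪ Extra₈.  The layers are monotone in U, and a
-- larger V ⊆ D can only move to a later case (by excluded middle every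
-- nonempty V ⊆ D is either a proper subset of D or D itself).  So we
-- prove entry lemmas: W ⊆ G₀ V always, the small layer of V lies in G₀ V
-- once V is nonempty, and the middle layer once D₂(V) is nonempty.  From
-- these, U ⊆ V ⊆ D gives G₀ U ⊆ G₀ V.  One closure step is monotone in
-- the set it is applied to, hence every Gₙ, their union G, and F (defined
-- from G) are monotone.

open import Defs
open import Level using (0ℓ)
open import Data.Nat using (ℕ; zero; suc)
open import Data.Product using (_×_; _,_; ∃)
open import Data.Sum using (_⊎_; inj₁; inj₂; map; map₁; map₂)
open import Function using (_∘_)
open import Relation.Nullary using (¬_; yes; no)
open import Relation.Nullary.Decidable using (decidable-stable)
open import Relation.Unary using (Pred; _⊆_)
open import Axiom.ExcludedMiddle using (ExcludedMiddle)

module Monotonicity (M : MALanguage) (g : GödelNumbering (MALanguage.LSent M)) where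
  open Construction M g

  Layer₂ Layer₄ Layer₈ : Pred ℕ 0ℓ → Pred ℕ 0ℓ
  Layer₂ V k = W k ⊎ D₁ V k ⊎ Extra₂ k
  Layer₄ V k = W k ⊎ D₁ V k ⊎ D₂ V k ⊎ Extra₄ k
  Layer₈ V k = W k ⊎ D₁ V k ⊎ D₂ V k ⊎ Extra₈ k

  Extra₂⊆Extra₄ : Extra₂ ⊆ Extra₄
  Extra₂⊆Extra₄ = map₂ inj₁

  Extra₄⊆Extra₈ : Extra₄ ⊆ Extra₈
  Extra₄⊆Extra₈ (inj₁ e)                 = inj₁ e
  Extra₄⊆Extra₈ (inj₂ (inj₁ e))          = inj₂ (inj₂ (inj₂ (inj₂ (inj₂ (inj₁ e)))))
  Extra₄⊆Extra₈ (inj₂ (inj₂ (inj₁ e)))   = inj₂ (inj₂ (inj₂ (inj₁ e)))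
  Extra₄⊆Extra₈ (inj₂ (inj₂ (inj₂ e)))   = inj₂ (inj₂ (inj₂ (inj₂ (inj₂ (inj₂ (inj₁ e))))))

  Layer₂⊆Layer₄ : ∀ {V} → Layer₂ V ⊆ Layer₄ V
  Layer₂⊆Layer₄ = map₂ (map₂ (inj₂ ∘ Extra₂⊆Extra₄))

  Layer₄⊆Layer₈ : ∀ {V} → Layer₄ V ⊆ Layer₈ V
  Layer₄⊆Layer₈ = map₂ (map₂ (map₂ Extra₄⊆Extra₈))

  D₁-mono : ∀ {U V} → U ⊆ V → D₁ U ⊆ D₁ V
  D₁-mono U⊆V (A , A∈U , eq) = A , U⊆V A∈U , eq

  D₂-mono : ∀ {U V} → U ⊆ V → D₂ U ⊆ D₂ V
  D₂-mono U⊆V (A , ¬A∈U , eq) = A , U⊆V ¬A∈U , eq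

  Layer₂-mono : ∀ {U V} → U ⊆ V → Layer₂ U ⊆ Layer₂ V
  Layer₂-mono {U} {V} U⊆V = map₂ (map₁ (D₁-mono {U} {V} U⊆V))

  Layer₄-mono : ∀ {U V} → U ⊆ V → Layer₄ U ⊆ Layer₄ V
  Layer₄-mono {U} {V} U⊆V =
    map₂ (map (D₁-mono {U} {V} U⊆V) (map₁ (D₂-mono {U} {V} U⊆V)))

  Layer₈-mono : ∀ {U V} → U ⊆ V → Layer₈ U ⊆ Layer₈ V
  Layer₈-mono {U} {V} U⊆V =
    map₂ (map (D₁-mono {U} {V} U⊆V) (map₁ (D₂-mono {U} {V} U⊆V)))

  NonEmpty-mono : ∀ {U V} → U ⊆ V → NonEmpty U → NonEmpty V
  NonEmpty-mono U⊆V (k , k∈U) = k , U⊆V k∈U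

  Step-mono : ∀ {X Y} → X ⊆ Y → Step X ⊆ Step Y
  Step-mono f (∨-l a)      = ∨-l (f a)
  Step-mono f (∨-r b)      = ∨-r (f b)
  Step-mono f (∧-i a b)    = ∧-i (f a) (f b)
  Step-mono f (⇒-l a)      = ⇒-l (f a)
  Step-mono f (⇒-r b)      = ⇒-r (f b)
  Step-mono f (⇔-tt a b)   = ⇔-tt (f a) (f b)
  Step-mono f (⇔-ff a b)   = ⇔-ff (f a) (f b)
  Step-mono f (¬∨-i a b)   = ¬∨-i (f a) (f b)
  Step-mono f (¬∧-l a)     = ¬∧-l (f a)
  Step-mono f (¬∧-r b)     = ¬∧-r (f b)
  Step-mono f (¬⇒-i a b)   = ¬⇒-i (f a) (f b)
  Step-mono f (¬⇔-tf a b)  = ¬⇔-tf (f a) (f b)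
  Step-mono f (¬⇔-ft a b)  = ¬⇔-ft (f a) (f b)
  Step-mono f (¬¬-i a)     = ¬¬-i (f a)

  Gₙ-mono : ∀ {U V} → G₀ U ⊆ G₀ V → ∀ n → Gₙ n U ⊆ Gₙ n V
  Gₙ-mono G₀⊆ zero            = G₀⊆
  Gₙ-mono G₀⊆ (suc n) (inj₁ x) = inj₁ (Gₙ-mono G₀⊆ n x)
  Gₙ-mono G₀⊆ (suc n) (inj₂ s) = inj₂ (Step-mono (Gₙ-mono G₀⊆ n) s)

  G-mono : ∀ {U V} → G₀ U ⊆ G₀ V → G U ⊆ G V
  G-mono G₀⊆ (n , x) = n , Gₙ-mono G₀⊆ n x

  F-mono : ∀ {U V} → G U ⊆ G V → F U ⊆ F V
  F-mono G⊆ (A , eq , ¬A∈GU) = A , eq , G⊆ ¬A∈GU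

  -- The remaining facts are classical: deciding which case of G₀ applies.
  module _ (em : ExcludedMiddle 0ℓ) {V : Pred ℕ 0ℓ} (V⊆D : V ⊆ D) where

    proper-or-D : NonEmpty V → ProperNonEmpty V ⊎ IsD V
    proper-or-D ne with em {∃ λ k → D k × ¬ V k}
    ... | yes missing = inj₁ (ne , V⊆D , missing)
    ... | no nothing-missing = inj₂ (V⊆D , D⊆V)
      where
      D⊆V : D ⊆ V
      D⊆V {k} k∈D = decidable-stable em λ k∉V → nothing-missing (k , k∈D , k∉V)

    Layer₂⊆G₀ : NonEmpty V → Layer₂ V ⊆ G₀ V
    Layer₂⊆G₀ ne x with proper-or-D ne | em {NonEmpty (D₂ V)}
    ... | inj₁ p   | yes d₂ = inj₂ (inj₂ (inj₁ (p , d₂ , Layer₂⊆Layer₄ {V} x)))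
    ... | inj₁ p   | no ¬d₂ = inj₂ (inj₁ (p , (λ k d → ¬d₂ (k , d)) , x))
    ... | inj₂ isD | _      = inj₂ (inj₂ (inj₂ (isD , Layer₄⊆Layer₈ {V} (Layer₂⊆Layer₄ {V} x))))

    Layer₄⊆G₀ : NonEmpty (D₂ V) → Layer₄ V ⊆ G₀ V
    Layer₄⊆G₀ d₂@(_ , A , ¬A∈V , _) x with proper-or-D (_ , ¬A∈V)
    ... | inj₁ p   = inj₂ (inj₂ (inj₁ (p , d₂ , x)))
    ... | inj₂ isD = inj₂ (inj₂ (inj₂ (isD , Layer₄⊆Layer₈ {V} x)))

    W⊆G₀ : W ⊆ G₀ V
    W⊆G₀ w with em {NonEmpty V}
    ... | yes ne = Layer₂⊆G₀ ne (inj₁ w)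
    ... | no ¬ne = inj₁ ((λ k v → ¬ne (k , v)) , w)

  -- G₀ is monotone on subsets of D: a larger set falls under a later case.
  G₀-mono : ExcludedMiddle 0ℓ → (U V : Pred ℕ 0ℓ) → V ⊆ D → U ⊆ V → G₀ U ⊆ G₀ V
  G₀-mono em U V V⊆D U⊆V (inj₁ (_ , w)) =
    W⊆G₀ em V⊆D w
  G₀-mono em U V V⊆D U⊆V (inj₂ (inj₁ ((ne , _) , _ , x))) =
    Layer₂⊆G₀ em V⊆D (NonEmpty-mono {U} {V} U⊆V ne) (Layer₂-mono {U} {V} U⊆V x)
  G₀-mono em U V V⊆D U⊆V (inj₂ (inj₂ (inj₁ (_ , d₂ , x)))) =
    Layer₄⊆G₀ em V⊆D (NonEmpty-mono {D₂ U} {D₂ V} (D₂-mono {U} {V} U⊆V) d₂)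
      (Layer₄-mono {U} {V} U⊆V x)
  G₀-mono em U V V⊆D U⊆V (inj₂ (inj₂ (inj₂ ((_ , D⊆U) , x)))) =
    inj₂ (inj₂ (inj₂ ((V⊆D , U⊆V ∘ D⊆U) , Layer₈-mono {U} {V} U⊆V x)))

lemma4p3 : ExcludedMiddle 0ℓ → (M : MALanguage) (g : GödelNumbering (MALanguage.LSent M))
    → let open Construction M g in
    (U V : Pred ℕ 0ℓ) → U ⊆ D → V ⊆ D → Consistent U → Consistent V → U ⊆ V
    → G U ⊆ G V × F U ⊆ F V
lemma4p3 em M g U V _ V⊆D _ _ U⊆V = GU⊆GV , F-mono {U} {V} GU⊆GV
  where
  open Construction M g
  open Monotonicity M g
  GU⊆GV : G U ⊆ G V
  GU⊆GV = G-mono {U} {V} (G₀-mono em U V V⊆D U⊆V)
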